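{- Let $G=(V,E)$ be a graph without isolated vertices with $\sigma(G)=2$, and let $\lambda$ be a sum labelling of $G+N_2$ whose two isolated vertices have labels $\iota_1,\iota_2$. If $\iota_1+\iota_2\ne\lambda(u)+\lambda(v)$ for any two vertices $u,v\in V$, then $\sigma(G+P_k)=1$ for every $k\ge 2$.
   Context: A graph $H=(V,E)$ is a sum graph with sum labelling $\lambda$ if $\lambda:V\to\mathbb{N}$ is injective and $E=\{xy : \exists z\in V,\ \lambda(z)=\lambda(x)+\lambda(y)\}$. For a graph $G$ without isolated vertices, $\sigma(G)$ is the minimum $k$ such that $G+N_k$ is a sum graph ($N_k$: $k$ isolated vertices, $+$: disjoint union). $P_k$ is the path on $k$ vertices. -}

module Defs where

open import Data.Nat using (ℕ; zero; suc; _+_; _<_)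
open import Data.Fin using (Fin; toℕ; splitAt)
open import Data.Sum using (_⊎_; inj₁; inj₂)
open import Data.Product using (_×_; ∃; _,_)
open import Data.Empty using (⊥)
open import Relation.Nullary using (¬_)
open import Relation.Binary.PropositionalEquality using (_≡_; _≢_)
open import Function.Definitions using (Injective)
open import Function.Bundles using (_⇔_)
open import Data.Nat.Properties using (1+n≢n)

record Graph : Set₁ where
  field
    n      : ℕ
    Adj    : Fin n → Fin n → Set
    adj-sym    : ∀ {x y} → Adj x y → Adj y x
    adj-irrefl : ∀ {x} → ¬ Adj x x
open Graph public

UAdj : ∀ {a b} → (Fin a → Fin a → Set) → (Fin b → Fin b → Set) →
       Fin a ⊎ Fin b → Fin a ⊎ Fin b → Set
UAdj A B (inj₁ x) (inj₁ y) = A x y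
UAdj A B (inj₂ x) (inj₂ y) = B x y
UAdj A B _ _ = ⊥

UAdj-sym : (G H : Graph) → ∀ u v → UAdj (Adj G) (Adj H) u v → UAdj (Adj G) (Adj H) v u
UAdj-sym G H (inj₁ x) (inj₁ y) e = adj-sym G e
UAdj-sym G H (inj₂ x) (inj₂ y) e = adj-sym H e

UAdj-irrefl : (G H : Graph) → ∀ u → ¬ UAdj (Adj G) (Adj H) u u
UAdj-irrefl G H (inj₁ x) e = adj-irrefl G e
UAdj-irrefl G H (inj₂ x) e = adj-irrefl H e

infixl 6 _⊕_
_⊕_ : Graph → Graph → Graph
G ⊕ H = record
  { n   = n G + n H
  ; Adj = λ x y → UAdj (Adj G) (Adj H) (splitAt (n G) x) (splitAt (n G) y)
  ; adj-sym    = λ {x} {y} → UAdj-sym G H (splitAt (n G) x) (splitAt (n G) y)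
  ; adj-irrefl = λ {x} → UAdj-irrefl G H (splitAt (n G) x)
  }

N : ℕ → Graph
N k = record { n = k ; Adj = λ _ _ → ⊥ ; adj-sym = λ () ; adj-irrefl = λ () }

PathAdj : ∀ {k} → Fin k → Fin k → Set
PathAdj i j = suc (toℕ i) ≡ toℕ j ⊎ suc (toℕ j) ≡ toℕ i

PathAdj-sym : ∀ {k} {i j : Fin k} → PathAdj i j → PathAdj j i
PathAdj-sym (inj₁ e) = inj₂ e
PathAdj-sym (inj₂ e) = inj₁ e

n≢sucn : ∀ m → ¬ suc m ≡ m
n≢sucn m = 1+n≢n

PathAdj-irrefl : ∀ {k} {i : Fin k} → ¬ PathAdj i i
PathAdj-irrefl {i = i} (inj₁ e) = n≢sucn (toℕ i) e
PathAdj-irrefl {i = i} (inj₂ e) = n≢sucn (toℕ i) e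

P : ℕ → Graph
P k = record { n = k ; Adj = PathAdj ; adj-sym = PathAdj-sym ; adj-irrefl = PathAdj-irrefl }

NoIsolated : Graph → Set
NoIsolated G = ∀ v → ∃ λ w → Adj G v w

IsSumLabelling : (G : Graph) → (Fin (n G) → ℕ) → Set
IsSumLabelling G ℓ =
  Injective _≡_ _≡_ ℓ ×
  (∀ v → 0 < ℓ v) ×
  (∀ x y → x ≢ y → (Adj G x y ⇔ (∃ λ z → ℓ z ≡ ℓ x + ℓ y)))

IsSumGraph : Graph → Set
IsSumGraph G = ∃ λ ℓ → IsSumLabelling G ℓ

SumNumberIs : Graph → ℕ → Set
SumNumberIs G k = IsSumGraph (G ⊕ N k) × (∀ j → j < k → ¬ IsSumGraph (G ⊕ N j))

-- Let g be the labels of G and a < b those of the two isolated vertices. All labels of G lie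
-- below b: the largest one has a neighbour, and their sum is a label, necessarily an isolated one.
-- Label the path by the Fibonacci sequence x₀ = a, x₁ = b, x_{i+2} = x_i + x_{i+1} and the new
-- isolated vertex by x_k. Consecutive path labels sum to a label; every other new sum lies strictly
-- between two consecutive terms x_j < t < x_{j+1} (j ≥ 1) or above x_k, so it is not a label.
-- The only new label that a sum of two labels of G could hit is x₂ = a + b, which the hypothesis
-- excludes; x₀, x₁ were labels before, and x_{i≥3} > 2b. Finally σ ≥ 1 because in a sum graph
-- without isolated vertices the largest label would have a neighbour summing above it.

{-# OPTIONS --safe #-}
module Submission where

open import Defs
open import Data.Nat using (ℕ; zero; suc; _+_; _≤_; _<_; z≤n; s≤s; _⊔_; _≤?_)
open import Data.Nat.Properties
open import Data.Fin using (Fin; zero; suc; toℕ; fromℕ<; splitAt; join; _↑ˡ_; _↑ʳ_; inject₁)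
open import Data.Fin.Properties
  using (toℕ-injective; toℕ<n; toℕ-fromℕ<; toℕ-inject₁; splitAt-↑ˡ; splitAt-↑ʳ;
         splitAt-join; join-splitAt; splitAt⁻¹-↑ˡ; splitAt⁻¹-↑ʳ; ↑ˡ-injective; ↑ʳ-injective)
open import Data.List using (allFin)
open import Data.List.Extrema.Nat using (argmax; f[xs]≤f[argmax])
open import Data.List.Membership.Propositional.Properties using (∈-allFin)
open import Data.List.Relation.Unary.All using (lookup)
open import Data.Sum using (_⊎_; inj₁; inj₂; [_,_]; [_,_]′; swap; map₂)
open import Data.Product using (_×_; ∃; _,_; proj₁; proj₂)
open import Data.Empty using (⊥-elim)
open import Relation.Nullary using (¬_; yes; no; contradiction)
open import Relation.Binary.PropositionalEquality
  using (_≡_; _≢_; refl; sym; trans; cong; subst; subst₂; module ≡-Reasoning)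
open import Relation.Binary.Definitions using (tri<; tri≈; tri>)
open import Function.Base using (_∘_; _on_)
open import Function.Definitions using (Injective)
open import Function.Bundles using (_⇔_; mk⇔; Equivalence)
open import Function.Construct.Composition using (_⇔-∘_)
open import Function.Construct.Symmetry using (⇔-sym)

open Equivalence using (to; from)

module StrictlyIncreasing {f : ℕ → ℕ} (f-<-suc : ∀ i → f i < f (suc i)) where

  mono-< : ∀ {i j} → i < j → f i < f j
  mono-< {i} {suc j} i<1+j with m<1+n⇒m<n∨m≡n i<1+j
  ... | inj₁ i<j  = <-trans (mono-< i<j) (f-<-suc j)
  ... | inj₂ refl = f-<-suc i

  mono-≤ : ∀ {i j} → i ≤ j → f i ≤ f j
  mono-≤ i≤j with m≤n⇒m<n∨m≡n i≤j
  ... | inj₁ i<j  = <⇒≤ (mono-< i<j)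
  ... | inj₂ refl = ≤-refl

  injective : Injective _≡_ _≡_ f
  injective {i} {j} e with <-cmp i j
  ... | tri< i<j _ _ = contradiction e (<⇒≢ (mono-< i<j))
  ... | tri≈ _ i≡j _ = i≡j
  ... | tri> _ _ j<i = contradiction (sym e) (<⇒≢ (mono-< j<i))

  between⇒≢ : ∀ j {t} → f j < t → t < f (suc j) → ∀ i → f i ≢ t
  between⇒≢ j lo hi i refl with i ≤? j
  ... | yes i≤j = <⇒≱ lo (mono-≤ i≤j)
  ... | no  i≰j = <⇒≱ hi (mono-≤ (≰⇒> i≰j))

fibFrom : ℕ → ℕ → ℕ → ℕ
fibFrom a b zero          = a
fibFrom a b (suc zero)    = b
fibFrom a b (suc (suc i)) = fibFrom a b i + fibFrom a b (suc i)

module FibFrom {a b : ℕ} (0<a : 0 < a) (a<b : a < b) where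

  positive : ∀ i → 0 < fibFrom a b i
  positive zero          = 0<a
  positive (suc zero)    = <-trans 0<a a<b
  positive (suc (suc i)) = <-≤-trans (positive i) (m≤m+n _ _)

  <-suc : ∀ i → fibFrom a b i < fibFrom a b (suc i)
  <-suc zero    = a<b
  <-suc (suc i) = m<n+m _ (positive i)

  open StrictlyIncreasing <-suc public

splitAt-injective : ∀ m {n} → Injective _≡_ _≡_ (splitAt m {n})
splitAt-injective m {n} {i} {j} e = begin
  i                     ≡⟨ join-splitAt m n i ⟨
  join m n (splitAt m i) ≡⟨ cong (join m n) e ⟩
  join m n (splitAt m j) ≡⟨ join-splitAt m n j ⟩
  j                     ∎
  where open ≡-Reasoning

↑ˡ≢↑ʳ : ∀ {m n} (u : Fin m) (i : Fin n) → u ↑ˡ n ≢ m ↑ʳ i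
↑ˡ≢↑ʳ {m} {n} u i e
  with trans (sym (splitAt-↑ˡ m u n)) (trans (cong (splitAt m) e) (splitAt-↑ʳ m n i))
... | ()

[,]′-injective : ∀ {A B C : Set} {f : A → C} {h : B → C} →
                 Injective _≡_ _≡_ f → Injective _≡_ _≡_ h → (∀ x y → f x ≢ h y) →
                 Injective _≡_ _≡_ [ f , h ]′
[,]′-injective f-inj h-inj f≢h {inj₁ x} {inj₁ x′} e = cong inj₁ (f-inj e)
[,]′-injective f-inj h-inj f≢h {inj₁ x} {inj₂ y}  e = contradiction e (f≢h x y)
[,]′-injective f-inj h-inj f≢h {inj₂ y} {inj₁ x}  e = contradiction (sym e) (f≢h x y)
[,]′-injective f-inj h-inj f≢h {inj₂ y} {inj₂ y′} e = cong inj₂ (h-inj e)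

argmaxFin : ∀ {m} (f : Fin m → ℕ) → Fin m → ∃ λ i → ∀ j → f j ≤ f i
argmaxFin f i₀ =
  argmax f i₀ (allFin _) , λ j → lookup (f[xs]≤f[argmax] i₀ (allFin _)) (∈-allFin j)

Image : {A : Set} → (A → ℕ) → ℕ → Set
Image ℓ t = ∃ λ z → ℓ z ≡ t

-- IsSumLabelling G ℓ is definitionally Injective ℓ × positivity × SumsIn (Adj G) ℓ (Image ℓ);
-- S abstracts the set of labels available as sums.
SumsIn : {A : Set} → (A → A → Set) → (A → ℕ) → (ℕ → Set) → Set
SumsIn E ℓ S = ∀ x y → x ≢ y → (E x y ⇔ S (ℓ x + ℓ y))

SumsIn-∘ : ∀ {A B : Set} {E : A → A → Set} {ℓ : A → ℕ} {S : ℕ → Set} {f : B → A} →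
           Injective _≡_ _≡_ f → SumsIn E ℓ S → SumsIn (E on f) (ℓ ∘ f) S
SumsIn-∘ f-inj sums x y x≢y = sums _ _ (x≢y ∘ f-inj)

SumsIn-⇔ : ∀ {A : Set} {E : A → A → Set} {ℓ : A → ℕ} {S S′ : ℕ → Set} →
           (∀ t → S t ⇔ S′ t) → SumsIn E ℓ S → SumsIn E ℓ S′
SumsIn-⇔ S⇔S′ sums x y x≢y = S⇔S′ _ ⇔-∘ sums x y x≢y

adj⇒≢ : (H : Graph) {x y : Fin (n H)} → Adj H x y → x ≢ y
adj⇒≢ H xy refl = adj-irrefl H xy

edge⇒larger-label : (H : Graph) {ℓ : Fin (n H) → ℕ} → IsSumLabelling H ℓ →
                    ∀ {x y} → Adj H x y → ∃ λ z → ℓ x < ℓ z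
edge⇒larger-label H {ℓ} (_ , positive , sums) {x} {y} xy
  with to (sums x y (adj⇒≢ H xy)) xy
... | z , e = z , subst (ℓ x <_) (sym e) (m<m+n (ℓ x) (positive y))

noIsolated⇒¬sumGraph : (H : Graph) → NoIsolated H → Fin (n H) → ¬ IsSumGraph H
noIsolated⇒¬sumGraph H noIsolated v (ℓ , labelling) with argmaxFin ℓ v
... | top , ℓ≤top with edge⇒larger-label H labelling (proj₂ (noIsolated top))
... | z , top<z = <⇒≱ top<z (ℓ≤top z)

module _ (G H : Graph) where

  ⊕-↑ˡ-adj : ∀ {u v} → Adj (G ⊕ H) (u ↑ˡ n H) (v ↑ˡ n H) ⇔ Adj G u v
  ⊕-↑ˡ-adj {u} {v} = mk⇔
    (subst₂ (UAdj (Adj G) (Adj H)) (splitAt-↑ˡ (n G) u (n H)) (splitAt-↑ˡ (n G) v (n H)))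
    (subst₂ (UAdj (Adj G) (Adj H)) (sym (splitAt-↑ˡ (n G) u (n H))) (sym (splitAt-↑ˡ (n G) v (n H))))

  ⊕-↑ˡ↑ʳ-nonadj : ∀ {u i} → ¬ Adj (G ⊕ H) (u ↑ˡ n H) (n G ↑ʳ i)
  ⊕-↑ˡ↑ʳ-nonadj {u} {i} =
    subst₂ (UAdj (Adj G) (Adj H)) (splitAt-↑ˡ (n G) u (n H)) (splitAt-↑ʳ (n G) (n H) i)

  ⊕-noIsolated : NoIsolated G → NoIsolated H → NoIsolated (G ⊕ H)
  ⊕-noIsolated noIsolatedG noIsolatedH z with splitAt (n G) z
  ... | inj₁ u = let v , uv = noIsolatedG u in
    v ↑ˡ n H , subst (UAdj (Adj G) (Adj H) (inj₁ u)) (sym (splitAt-↑ˡ (n G) v (n H))) uv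
  ... | inj₂ i = let j , ij = noIsolatedH i in
    n G ↑ʳ j , subst (UAdj (Adj G) (Adj H) (inj₂ i)) (sym (splitAt-↑ʳ (n G) (n H) j)) ij

P-noIsolated : ∀ {k} → 2 ≤ k → NoIsolated (P k)
P-noIsolated {suc (suc k)} _ zero    = suc zero , inj₁ refl
P-noIsolated {suc (suc k)} _ (suc i) = inject₁ i , inj₂ (cong suc (toℕ-inject₁ i))
P-noIsolated {suc zero} (s≤s ())

InLabels : ∀ {m} → (Fin m → ℕ) → ℕ → ℕ → ℕ → Set
InLabels g a b t = Image g t ⊎ (t ≡ a ⊎ t ≡ b)

InLabels-swap : ∀ {m} (g : Fin m → ℕ) a b t → InLabels g a b t ⇔ InLabels g b a t
InLabels-swap g a b t = mk⇔ (map₂ swap) (map₂ swap)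

record TwoIsolatedLabelling (G : Graph) (g : Fin (n G) → ℕ) (a b : ℕ) : Set where
  field
    g-injective    : Injective _≡_ _≡_ g
    g-positive     : ∀ u → 0 < g u
    a-positive     : 0 < a
    b-positive     : 0 < b
    g≢a            : ∀ u → g u ≢ a
    g≢b            : ∀ u → g u ≢ b
    sums           : SumsIn (Adj G) g (InLabels g a b)
    g+a-unlabelled : ∀ u → ¬ InLabels g a b (g u + a)
    g+b-unlabelled : ∀ u → ¬ InLabels g a b (g u + b)

TwoIsolatedLabelling-swap : ∀ {G} {g : Fin (n G) → ℕ} {a b} →
                            TwoIsolatedLabelling G g a b → TwoIsolatedLabelling G g b a
TwoIsolatedLabelling-swap {g = g} {a} {b} L = record
  { g-injective    = g-injective
  ; g-positive     = g-positive
  ; a-positive     = b-positive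
  ; b-positive     = a-positive
  ; g≢a            = g≢b
  ; g≢b            = g≢a
  ; sums           = SumsIn-⇔ {ℓ = g} (InLabels-swap g a b) sums
  ; g+a-unlabelled = λ u → g+b-unlabelled u ∘ to (InLabels-swap g b a _)
  ; g+b-unlabelled = λ u → g+a-unlabelled u ∘ to (InLabels-swap g b a _)
  }
  where open TwoIsolatedLabelling L

module OfSumLabelling {G : Graph} {ℓ : Fin (n G + 2) → ℕ}
                      (labelling : IsSumLabelling (G ⊕ N 2) ℓ) where

  g : Fin (n G) → ℕ
  g u = ℓ (u ↑ˡ 2)

  ι₁ ι₂ : ℕ
  ι₁ = ℓ (n G ↑ʳ zero)
  ι₂ = ℓ (n G ↑ʳ suc zero)

  private
    ℓ-injective : Injective _≡_ _≡_ ℓ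
    ℓ-injective = proj₁ labelling

    ℓ-positive : ∀ z → 0 < ℓ z
    ℓ-positive = proj₁ (proj₂ labelling)

    ℓ-sums : SumsIn (Adj (G ⊕ N 2)) ℓ (Image ℓ)
    ℓ-sums = proj₂ (proj₂ labelling)

  Image⇔InLabels : ∀ t → Image ℓ t ⇔ InLabels g ι₁ ι₂ t
  Image⇔InLabels t = mk⇔ image⇒labels labels⇒image
    where
    image⇒labels : Image ℓ t → InLabels g ι₁ ι₂ t
    image⇒labels (z , e) with splitAt (n G) z in eq
    ... | inj₁ u          = inj₁ (u , trans (cong ℓ (splitAt⁻¹-↑ˡ eq)) e)
    ... | inj₂ zero       = inj₂ (inj₁ (trans (sym e) (cong ℓ (sym (splitAt⁻¹-↑ʳ eq)))))
    ... | inj₂ (suc zero) = inj₂ (inj₂ (trans (sym e) (cong ℓ (sym (splitAt⁻¹-↑ʳ eq)))))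

    labels⇒image : InLabels g ι₁ ι₂ t → Image ℓ t
    labels⇒image (inj₁ (u , e))    = u ↑ˡ 2 , e
    labels⇒image (inj₂ (inj₁ e)) = n G ↑ʳ zero , sym e
    labels⇒image (inj₂ (inj₂ e)) = n G ↑ʳ suc zero , sym e

  ι₁≢ι₂ : ι₁ ≢ ι₂
  ι₁≢ι₂ e with ↑ʳ-injective (n G) zero (suc zero) (ℓ-injective e)
  ... | ()

  twoIsolated : TwoIsolatedLabelling G g ι₁ ι₂
  twoIsolated = record
    { g-injective    = λ e → ↑ˡ-injective 2 _ _ (ℓ-injective e)
    ; g-positive     = λ u → ℓ-positive (u ↑ˡ 2)
    ; a-positive     = ℓ-positive (n G ↑ʳ zero)
    ; b-positive     = ℓ-positive (n G ↑ʳ suc zero)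
    ; g≢a            = λ u → ↑ˡ≢↑ʳ u zero ∘ ℓ-injective
    ; g≢b            = λ u → ↑ˡ≢↑ʳ u (suc zero) ∘ ℓ-injective
    ; sums           = λ u v u≢v →
        Image⇔InLabels _ ⇔-∘
          (ℓ-sums (u ↑ˡ 2) (v ↑ˡ 2) (u≢v ∘ ↑ˡ-injective 2 u v) ⇔-∘ ⇔-sym (⊕-↑ˡ-adj G (N 2)))
    ; g+a-unlabelled = isolated-unlabelled zero
    ; g+b-unlabelled = isolated-unlabelled (suc zero)
    }
    where
    isolated-unlabelled : ∀ i u → ¬ InLabels g ι₁ ι₂ (g u + ℓ (n G ↑ʳ i))
    isolated-unlabelled i u labelled = ⊕-↑ˡ↑ʳ-nonadj G (N 2)
      (from (ℓ-sums (u ↑ˡ 2) (n G ↑ʳ i) (↑ˡ≢↑ʳ u i)) (from (Image⇔InLabels _) labelled))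

  g<ι₁⊔ι₂ : NoIsolated G → ∀ u → g u < ι₁ ⊔ ι₂
  g<ι₁⊔ι₂ noIsolated u with argmaxFin g u
  ... | top , g≤top
    with edge⇒larger-label (G ⊕ N 2) labelling (from (⊕-↑ˡ-adj G (N 2)) (proj₂ (noIsolated top)))
  ... | z , top<z with to (Image⇔InLabels (ℓ z)) (z , refl)
  ... | inj₁ (v , e)  = contradiction (subst (_≤ g top) e (g≤top v)) (<⇒≱ top<z)
  ... | inj₂ (inj₁ e) =
    ≤-<-trans (g≤top u) (<-≤-trans (subst (g top <_) e top<z) (m≤m⊔n ι₁ ι₂))
  ... | inj₂ (inj₂ e) =
    ≤-<-trans (g≤top u) (<-≤-trans (subst (g top <_) e top<z) (m≤n⊔m ι₁ ι₂))

module Extension {G : Graph} {g : Fin (n G) → ℕ} {a b : ℕ} (L : TwoIsolatedLabelling G g a b)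
  (a<b : a < b) (g<b : ∀ u → g u < b) (a+b≢g+g : ∀ u v → u ≢ v → a + b ≢ g u + g v)
  (k : ℕ) (2≤k : 2 ≤ k) where

  open TwoIsolatedLabelling L
  open FibFrom a-positive a<b renaming (injective to x-injective)

  x : ℕ → ℕ
  x = fibFrom a b

  1≤k : 1 ≤ k
  1≤k = ≤-trans (s≤s z≤n) 2≤k

  g<x : ∀ u {i} → 1 ≤ i → g u < x i
  g<x u 1≤i = <-≤-trans (g<b u) (mono-≤ 1≤i)

  g≢x : ∀ u i → g u ≢ x i
  g≢x u zero    = g≢a u
  g≢x u (suc i) = <⇒≢ (g<x u {suc i} (s≤s z≤n))

  b+b<x₃ : b + b < x 3
  b+b<x₃ = +-monoʳ-< b (m<n+m b a-positive)

  g+a<x₂ : ∀ u → g u + a < x 2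
  g+a<x₂ u = subst (g u + a <_) (+-comm b a) (+-monoˡ-< a (g<b u))

  NewLabel : ℕ → Set
  NewLabel t = Image g t ⊎ (∃ λ i → i ≤ k × x i ≡ t)

  above-top⇒unlabelled : ∀ {t} → x k < t → ¬ NewLabel t
  above-top⇒unlabelled xk<t (inj₁ (u , refl))          = <-asym (g<x u 1≤k) xk<t
  above-top⇒unlabelled xk<t (inj₂ (i , i≤k , refl)) = <⇒≱ xk<t (mono-≤ i≤k)

  between⇒unlabelled : ∀ j {t} → 1 ≤ j → x j < t → t < x (suc j) → ¬ NewLabel t
  between⇒unlabelled j 1≤j lo hi (inj₁ (u , refl))    = <-asym (g<x u 1≤j) lo
  between⇒unlabelled j 1≤j lo hi (inj₂ (i , _ , e)) = between⇒≢ j lo hi i e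

  below-x₃ : ∀ {t} → t < x 3 → NewLabel t → InLabels g a b t ⊎ t ≡ x 2
  below-x₃ t<x₃ (inj₁ image)                  = inj₁ (inj₁ image)
  below-x₃ t<x₃ (inj₂ (0 , _ , e))             = inj₁ (inj₂ (inj₁ (sym e)))
  below-x₃ t<x₃ (inj₂ (1 , _ , e))             = inj₁ (inj₂ (inj₂ (sym e)))
  below-x₃ t<x₃ (inj₂ (2 , _ , e))             = inj₂ (sym e)
  below-x₃ t<x₃ (inj₂ (suc (suc (suc i)) , _ , refl)) =
    contradiction (mono-≤ {3} {3 + i} (s≤s (s≤s (s≤s z≤n)))) (<⇒≱ t<x₃)

  InLabels⇔NewLabel : ∀ u v → u ≢ v → InLabels g a b (g u + g v) ⇔ NewLabel (g u + g v)
  InLabels⇔NewLabel u v u≢v = mk⇔ old⇒new new⇒old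
    where
    old⇒new : InLabels g a b (g u + g v) → NewLabel (g u + g v)
    old⇒new (inj₁ image)     = inj₁ image
    old⇒new (inj₂ (inj₁ e)) = inj₂ (0 , z≤n , sym e)
    old⇒new (inj₂ (inj₂ e)) = inj₂ (1 , 1≤k , sym e)

    new⇒old : NewLabel (g u + g v) → InLabels g a b (g u + g v)
    new⇒old new with below-x₃ (<-trans (+-mono-< (g<b u) (g<b v)) b+b<x₃) new
    ... | inj₁ old = old
    ... | inj₂ e   = contradiction (sym e) (a+b≢g+g u v u≢v)

  g+x-unlabelled : ∀ u i → ¬ NewLabel (g u + x i)
  g+x-unlabelled u zero new with below-x₃ (<-trans (g+a<x₂ u) (<-suc 2)) new
  ... | inj₁ old = g+a-unlabelled u old
  ... | inj₂ e   = <⇒≢ (g+a<x₂ u) e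
  g+x-unlabelled u (suc zero) new with below-x₃ (<-trans (+-monoˡ-< b (g<b u)) b+b<x₃) new
  ... | inj₁ old = g+b-unlabelled u old
  ... | inj₂ e   = g≢a u (+-cancelʳ-≡ b (g u) a e)
  g+x-unlabelled u (suc (suc i)) = between⇒unlabelled (2 + i) (s≤s z≤n)
    (m<n+m _ (g-positive u)) (+-monoˡ-< (x (2 + i)) (g<x u {1 + i} (s≤s z≤n)))

  ordered-path-adj⇔labelled : ∀ {i j} → i < j → j < k →
                              (suc i ≡ j ⊎ suc j ≡ i) ⇔ NewLabel (x i + x j)
  ordered-path-adj⇔labelled {i} {suc m} i<j j<k with i ≟ m
  ... | yes refl = mk⇔ (λ _ → inj₂ (suc (suc i) , j<k , refl)) (λ _ → inj₁ refl)
  ... | no  i≢m  = mk⇔ (⊥-elim ∘ nonadjacent) (⊥-elim ∘ unlabelled)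
    where
    i<m : i < m
    i<m = ≤∧≢⇒< (≤-pred i<j) i≢m

    nonadjacent : ¬ (suc i ≡ suc m ⊎ suc (suc m) ≡ i)
    nonadjacent (inj₁ e)    = i≢m (suc-injective e)
    nonadjacent (inj₂ refl) = <-asym i<j (n<1+n (suc m))

    unlabelled : ¬ NewLabel (x i + x (suc m))
    unlabelled = between⇒unlabelled (suc m) (s≤s z≤n)
      (m<n+m _ (positive i)) (+-monoˡ-< (x (suc m)) (mono-< i<m))

  path-adj⇔labelled : ∀ {i j} → i < k → j < k → i ≢ j →
                      (suc i ≡ j ⊎ suc j ≡ i) ⇔ NewLabel (x i + x j)
  path-adj⇔labelled {i} {j} i<k j<k i≢j with <-cmp i j
  ... | tri< i<j _ _ = ordered-path-adj⇔labelled i<j j<k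
  ... | tri≈ _ i≡j _ = contradiction i≡j i≢j
  ... | tri> _ _ j<i = subst (λ t → (suc i ≡ j ⊎ suc j ≡ i) ⇔ NewLabel t) (+-comm (x j) (x i))
                         (ordered-path-adj⇔labelled j<i i<k ⇔-∘ mk⇔ swap swap)

  inner : Fin (n G) ⊎ Fin k → ℕ
  inner = [ g , x ∘ toℕ ]′

  inner-positive : ∀ p → 0 < inner p
  inner-positive = [ g-positive , positive ∘ toℕ ]

  inner<x-top : ∀ p → inner p < x k
  inner<x-top = [ (λ u → g<x u 1≤k) , (λ p → mono-< (toℕ<n p)) ]

  inner-injective : Injective _≡_ _≡_ inner
  inner-injective =
    [,]′-injective g-injective (λ e → toℕ-injective (x-injective e)) (λ u p → g≢x u (toℕ p))

  inner-sums : SumsIn (UAdj (Adj G) (Adj (P k))) inner NewLabel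
  inner-sums (inj₁ u) (inj₁ v) u≢v =
    InLabels⇔NewLabel u v (u≢v ∘ cong inj₁) ⇔-∘ sums u v (u≢v ∘ cong inj₁)
  inner-sums (inj₁ u) (inj₂ p) _   = mk⇔ ⊥-elim (⊥-elim ∘ g+x-unlabelled u (toℕ p))
  inner-sums (inj₂ p) (inj₁ u) _   =
    mk⇔ ⊥-elim (⊥-elim ∘ g+x-unlabelled u (toℕ p) ∘ subst NewLabel (+-comm _ (g u)))
  inner-sums (inj₂ p) (inj₂ q) p≢q =
    path-adj⇔labelled (toℕ<n p) (toℕ<n q) (p≢q ∘ cong inj₂ ∘ toℕ-injective)

  outer : Fin (n G + k) ⊎ Fin 1 → ℕ
  outer = [ inner ∘ splitAt (n G) , (λ _ → x k) ]′

  outer-injective : Injective _≡_ _≡_ outer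
  outer-injective = [,]′-injective
    (λ e → splitAt-injective (n G) (inner-injective e))
    (λ { {zero} {zero} _ → refl })
    (λ w _ → <⇒≢ (inner<x-top (splitAt (n G) w)))

  outer-positive : ∀ r → 0 < outer r
  outer-positive = [ (λ w → inner-positive (splitAt (n G) w)) , (λ _ → positive k) ]

  outer-sums : SumsIn (UAdj (Adj (G ⊕ P k)) (Adj (N 1))) outer NewLabel
  outer-sums (inj₁ w) (inj₁ w′) w≢w′ =
    SumsIn-∘ {ℓ = inner} {S = NewLabel} (splitAt-injective (n G)) inner-sums w w′ (w≢w′ ∘ cong inj₁)
  outer-sums (inj₁ w) (inj₂ _) _   =
    mk⇔ ⊥-elim (⊥-elim ∘ above-top⇒unlabelled (m<n+m (x k) (inner-positive (splitAt (n G) w))))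
  outer-sums (inj₂ _) (inj₁ w) _   =
    mk⇔ ⊥-elim (⊥-elim ∘ above-top⇒unlabelled (m<m+n (x k) (inner-positive (splitAt (n G) w))))
  outer-sums (inj₂ zero) (inj₂ zero) r≢r = contradiction refl r≢r

  label : Fin (n ((G ⊕ P k) ⊕ N 1)) → ℕ
  label = outer ∘ splitAt (n G + k)

  NewLabel⇔Image : ∀ t → NewLabel t ⇔ Image label t
  NewLabel⇔Image t = mk⇔ new⇒image image⇒new
    where
    outer-image : ∀ r → Image label (outer r)
    outer-image r = join (n G + k) 1 r , cong outer (splitAt-join (n G + k) 1 r)

    inner-image : ∀ p → Image label (inner p)
    inner-image p =
      subst (Image label) (cong inner (splitAt-join (n G) k p)) (outer-image (inj₁ (join (n G) k p)))

    new⇒image : NewLabel t → Image label t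
    new⇒image (inj₁ (u , refl)) = inner-image (inj₁ u)
    new⇒image (inj₂ (i , i≤k , refl)) with m≤n⇒m<n∨m≡n i≤k
    ... | inj₁ i<k  =
      subst (Image label) (cong x (toℕ-fromℕ< i<k)) (inner-image (inj₂ (fromℕ< i<k)))
    ... | inj₂ refl = outer-image (inj₂ zero)

    inner-new : ∀ p → NewLabel (inner p)
    inner-new (inj₁ u) = inj₁ (u , refl)
    inner-new (inj₂ p) = inj₂ (toℕ p , <⇒≤ (toℕ<n p) , refl)

    image⇒new : Image label t → NewLabel t
    image⇒new (z , refl) with splitAt (n G + k) z
    ... | inj₁ w = inner-new (splitAt (n G) w)
    ... | inj₂ _ = inj₂ (k , ≤-refl , refl)

  sumGraph : IsSumGraph ((G ⊕ P k) ⊕ N 1)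
  sumGraph = label
           , (λ e → splitAt-injective (n G + k) (outer-injective e))
           , (λ z → outer-positive (splitAt (n G + k) z))
           , SumsIn-⇔ {ℓ = label} NewLabel⇔Image
               (SumsIn-∘ {ℓ = outer} {S = NewLabel} (splitAt-injective (n G + k)) outer-sums)

proposition13 : (G : Graph) → NoIsolated G → SumNumberIs G 2 →
    (ℓ : Fin (n G + 2) → ℕ) → IsSumLabelling (G ⊕ N 2) ℓ →
    (∀ (u v : Fin (n G)) → u ≢ v →
      ℓ (n G ↑ʳ zero) + ℓ (n G ↑ʳ suc zero) ≢ ℓ (u ↑ˡ 2) + ℓ (v ↑ˡ 2)) →
    ∀ (k : ℕ) → 2 ≤ k → SumNumberIs (G ⊕ P k) 1
proposition13 G noIsolated _ ℓ labelling ι₁+ι₂≢g+g k 2≤k = sumGraph , notSumGraph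
  where
  open OfSumLabelling {G} {ℓ} labelling

  sumGraph : IsSumGraph ((G ⊕ P k) ⊕ N 1)
  sumGraph with <-cmp ι₁ ι₂
  ... | tri< ι₁<ι₂ _ _ = Extension.sumGraph twoIsolated ι₁<ι₂
        (λ u → subst (g u <_) (m≤n⇒m⊔n≡n (<⇒≤ ι₁<ι₂)) (g<ι₁⊔ι₂ noIsolated u))
        ι₁+ι₂≢g+g k 2≤k
  ... | tri≈ _ ι₁≡ι₂ _ = contradiction ι₁≡ι₂ ι₁≢ι₂
  ... | tri> _ _ ι₂<ι₁ = Extension.sumGraph (TwoIsolatedLabelling-swap twoIsolated) ι₂<ι₁
        (λ u → subst (g u <_) (m≥n⇒m⊔n≡m (<⇒≤ ι₂<ι₁)) (g<ι₁⊔ι₂ noIsolated u))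
        (λ u v u≢v → ι₁+ι₂≢g+g u v u≢v ∘ trans (+-comm ι₁ ι₂)) k 2≤k

  notSumGraph : ∀ j → j < 1 → ¬ IsSumGraph ((G ⊕ P k) ⊕ N j)
  notSumGraph zero _ = noIsolated⇒¬sumGraph ((G ⊕ P k) ⊕ N 0)
    (⊕-noIsolated (G ⊕ P k) (N 0) (⊕-noIsolated G (P k) noIsolated (P-noIsolated 2≤k)) (λ ()))
    ((n G ↑ʳ fromℕ< 2≤k) ↑ˡ 0)
  notSumGraph (suc j) (s≤s ())
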